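{- Let $q$ be a prime power, $d$ a positive divisor of $q-1$, $m\ge2$ an integer, and let $G=\{x^d: x\in\mathbb{F}_q^\times\}$ be the subgroup of $d$-th powers in $\mathbb{F}_q^\times$. Suppose $G$ is a cap in the sense that there are no pairwise distinct $x_1,\dots,x_m\in G$ with $x_1+\dots+x_m=0$. Call an element $y\in\mathbb{F}_q\setminus G$ represented by $G$ if there exist pairwise distinct $x_1,\dots,x_{m-1}\in G$ with $y+x_1+\dots+x_{m-1}=0$, and call $G$ complete if every $y\in\mathbb{F}_q\setminus G$ is represented by $G$. Let $g$ be a generator of the cyclic group $\mathbb{F}_q^\times$. If $0$ and all powers $g^k$ with $1\le k\le d-1$ are represented by $G$, then $G$ is complete. -}

module Defs where

open import Level using (Level; _⊔_)
open import Algebra.Bundles using (CommutativeRing)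
open import Data.Nat using (ℕ; zero; suc; _≤_; _^_; _∸_)
open import Data.Nat.Primality using (Prime)
open import Data.Fin as Fin using (Fin)
open import Data.Product using (∃; ∃-syntax; _×_)
open import Relation.Nullary using (¬_)
open import Relation.Binary.PropositionalEquality using (_≡_)

IsPrimePower : ℕ → Set
IsPrimePower q = ∃[ p ] ∃[ k ] (Prime p × 1 ≤ k × q ≡ p ^ k)

module _ {c ℓ : Level} (R : CommutativeRing c ℓ) where
  open CommutativeRing R hiding (zero)

  record IsFiniteFieldOfSize (q : ℕ) : Set (c ⊔ ℓ) where
    field
      0≉1      : ¬ (0# ≈ 1#)
      inverse  : ∀ x → ¬ (x ≈ 0#) → ∃[ y ] (x * y ≈ 1#)
      enum     : Fin q → Carrier
      enum-inj : ∀ i j → enum i ≈ enum j → i ≡ j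
      enum-sur : ∀ x → ∃[ i ] (enum i ≈ x)

  pow : Carrier → ℕ → Carrier
  pow x zero    = 1#
  pow x (suc n) = x * pow x n

  sumFin : (n : ℕ) → (Fin n → Carrier) → Carrier
  sumFin zero    xs = 0#
  sumFin (suc n) xs = xs Fin.zero + sumFin n (λ i → xs (Fin.suc i))

  Distinct : {n : ℕ} → (Fin n → Carrier) → Set ℓ
  Distinct {n} xs = ∀ (i j : Fin n) → xs i ≈ xs j → i ≡ j

  InPowers : ℕ → Carrier → Set (c ⊔ ℓ)
  InPowers d y = ∃[ x ] (¬ (x ≈ 0#) × pow x d ≈ y)

  IsGenerator : Carrier → Set (c ⊔ ℓ)
  IsGenerator g = ¬ (g ≈ 0#) × (∀ x → ¬ (x ≈ 0#) → ∃[ k ] (pow g k ≈ x))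

  IsCap : ℕ → ℕ → Set (c ⊔ ℓ)
  IsCap d m = ¬ (∃[ xs ] (Distinct {m} xs × (∀ i → InPowers d (xs i)) × sumFin m xs ≈ 0#))

  Represented : ℕ → ℕ → Carrier → Set (c ⊔ ℓ)
  Represented d m y = ∃[ xs ] (Distinct {m ∸ 1} xs × (∀ i → InPowers d (xs i))
                               × y + sumFin (m ∸ 1) xs ≈ 0#)

  IsComplete : ℕ → ℕ → Set (c ⊔ ℓ)
  IsComplete d m = ∀ y → ¬ InPowers d y → Represented d m y

module Submission where

open import Defs
open import Level using (Level)
open import Algebra.Bundles using (CommutativeRing)
import Data.Nat as ℕ
import Data.Nat.Properties as ℕ
open import Data.Nat using (ℕ; zero; suc; _≤_; _<_; _∸_; NonZero; s≤s; z≤n)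
open import Data.Nat.Divisibility using (_∣_)
open import Data.Nat.DivMod using (_%_; _/_; m≡m%n+[m/n]*n; m%n<n)
open import Data.Fin using (Fin)
import Data.Fin.Properties as Fin
open import Data.Product using (_,_; _×_; ∃-syntax)
open import Data.Empty using (⊥-elim)
open import Relation.Nullary using (Dec; yes; no)
open import Relation.Binary.PropositionalEquality as ≡ using (_≡_; cong)

-- Every nonzero y is g^k = g^r · (g^(k/d))^d with r = k mod d,
-- i.e. y lies in the coset g^r G with 0 ≤ r < d; r = 0 would put y in G. Multiplying a
-- representation of g^r by the element (g^(k/d))^d of G keeps the summands distinct and
-- in G, so it represents y.

module _ {c ℓ : Level} (F : CommutativeRing c ℓ) where
  open CommutativeRing F
  open import Algebra.Properties.CommutativeSemiring.Exp commutativeSemiring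
    using (_^_; ^-homo-*; ^-assocʳ; ^-distrib-*)
  open import Algebra.Properties.Semiring.Sum semiring using (sum; *-distribˡ-sum)
  open import Relation.Binary.Reasoning.Setoid setoid

  pow≡^ : ∀ x n → pow F x n ≡ x ^ n
  pow≡^ x zero    = ≡.refl
  pow≡^ x (suc n) = cong (x *_) (pow≡^ x n)

  sumFin≡sum : ∀ n (xs : Fin n → Carrier) → sumFin F n xs ≡ sum xs
  sumFin≡sum zero    xs = ≡.refl
  sumFin≡sum (suc n) xs = cong (xs Fin.zero +_) (sumFin≡sum n (λ i → xs (Fin.suc i)))

  pow-distrib-* : ∀ x y n → pow F (x * y) n ≈ pow F x n * pow F y n
  pow-distrib-* x y n rewrite pow≡^ (x * y) n | pow≡^ x n | pow≡^ y n = ^-distrib-* x y n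

  pow-rem-quot : ∀ x k d .{{_ : NonZero d}} →
                 pow F x k ≈ pow F x (k % d) * pow F (pow F x (k / d)) d
  pow-rem-quot x k d
    rewrite pow≡^ x k | pow≡^ x (k % d) | pow≡^ x (k / d) | pow≡^ (x ^ (k / d)) d = begin
      x ^ k                           ≡⟨ cong (x ^_) (m≡m%n+[m/n]*n k d) ⟩
      x ^ (k % d ℕ.+ k / d ℕ.* d)     ≈⟨ ^-homo-* x (k % d) (k / d ℕ.* d) ⟩
      x ^ (k % d) * x ^ (k / d ℕ.* d) ≈⟨ *-congˡ (^-assocʳ x (k / d) d) ⟨
      x ^ (k % d) * (x ^ (k / d)) ^ d ∎

  *-distribˡ-sumFin : ∀ n h (xs : Fin n → Carrier) →
                      h * sumFin F n xs ≈ sumFin F n (λ i → h * xs i)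
  *-distribˡ-sumFin n h xs rewrite sumFin≡sum n xs | sumFin≡sum n (λ i → h * xs i) =
    *-distribˡ-sum h xs

  InPowers-resp-≈ : ∀ {d x y} → x ≈ y → InPowers F d x → InPowers F d y
  InPowers-resp-≈ x≈y (a , a≉0 , aᵈ≈x) = a , a≉0 , trans aᵈ≈x x≈y

  Represented-resp-≈ : ∀ {d m y z} → y ≈ z → Represented F d m y → Represented F d m z
  Represented-resp-≈ y≈z (xs , distinct , xs∈G , y+Σxs≈0) =
    xs , distinct , xs∈G , trans (+-congʳ (sym y≈z)) y+Σxs≈0

module _ {c ℓ : Level} (F : CommutativeRing c ℓ) {q : ℕ} (ff : IsFiniteFieldOfSize F q) where
  open CommutativeRing F
  open IsFiniteFieldOfSize ff
  open import Relation.Binary.Reasoning.Setoid setoid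

  ≈-dec : ∀ x y → Dec (x ≈ y)
  ≈-dec x y with enum-sur x | enum-sur y
  ... | i , eᵢ≈x | j , eⱼ≈y with i Fin.≟ j
  ... | yes ≡.refl = yes (trans (sym eᵢ≈x) eⱼ≈y)
  ... | no i≢j     = no λ x≈y → i≢j (enum-inj i j (trans eᵢ≈x (trans x≈y (sym eⱼ≈y))))

  *-cancelˡ-≉0 : ∀ {h} a b → h ≉ 0# → h * a ≈ h * b → a ≈ b
  *-cancelˡ-≉0 {h} a b h≉0 ha≈hb with inverse h h≉0
  ... | h⁻¹ , hh⁻¹≈1 = begin
    a              ≈⟨ undo a ⟩
    h⁻¹ * (h * a)  ≈⟨ *-congˡ ha≈hb ⟩
    h⁻¹ * (h * b)  ≈⟨ undo b ⟨
    b              ∎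
    where
    undo : ∀ x → x ≈ h⁻¹ * (h * x)
    undo x = begin
      x              ≈⟨ *-identityˡ x ⟨
      1# * x         ≈⟨ *-congʳ (trans (sym hh⁻¹≈1) (*-comm h h⁻¹)) ⟩
      h⁻¹ * h * x    ≈⟨ *-assoc h⁻¹ h x ⟩
      h⁻¹ * (h * x)  ∎

  *-≉0 : ∀ {x y} → x ≉ 0# → y ≉ 0# → x * y ≉ 0#
  *-≉0 {x} {y} x≉0 y≉0 xy≈0 = y≉0 (*-cancelˡ-≉0 y 0# x≉0 (trans xy≈0 (sym (zeroʳ x))))

  pow-≉0 : ∀ {x} n → x ≉ 0# → pow F x n ≉ 0#
  pow-≉0 zero    x≉0 1≈0 = 0≉1 (sym 1≈0)
  pow-≉0 (suc n) x≉0     = *-≉0 x≉0 (pow-≉0 n x≉0)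

  InPowers⇒≉0 : ∀ {d h} → InPowers F d h → h ≉ 0#
  InPowers⇒≉0 {d} (a , a≉0 , aᵈ≈h) h≈0 = pow-≉0 d a≉0 (trans aᵈ≈h h≈0)

  InPowers-* : ∀ {d x y} → InPowers F d x → InPowers F d y → InPowers F d (x * y)
  InPowers-* {d} (a , a≉0 , aᵈ≈x) (b , b≉0 , bᵈ≈y) =
    a * b , *-≉0 a≉0 b≉0 , trans (pow-distrib-* F a b d) (*-cong aᵈ≈x bᵈ≈y)

  Represented-*-InPowers : ∀ {d m h z} → InPowers F d h →
                           Represented F d m z → Represented F d m (h * z)
  Represented-*-InPowers {d} {m} {h} {z} h∈G (xs , distinct , xs∈G , z+Σxs≈0) =
    (λ i → h * xs i) ,
    (λ i j hxᵢ≈hxⱼ → distinct i j (*-cancelˡ-≉0 (xs i) (xs j) (InPowers⇒≉0 {d} h∈G) hxᵢ≈hxⱼ)) ,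
    (λ i → InPowers-* {d} h∈G (xs∈G i)) ,
    (begin
      h * z + sumFin F (m ∸ 1) (λ i → h * xs i) ≈⟨ +-congˡ (*-distribˡ-sumFin F (m ∸ 1) h xs) ⟨
      h * z + h * sumFin F (m ∸ 1) xs            ≈⟨ distribˡ h z _ ⟨
      h * (z + sumFin F (m ∸ 1) xs)              ≈⟨ *-congˡ z+Σxs≈0 ⟩
      h * 0#                                     ≈⟨ zeroʳ h ⟩
      0#                                         ∎)

  ≉0⇒∈coset : ∀ {g y} d .{{_ : NonZero d}} → IsGenerator F g → y ≉ 0# →
              ∃[ r ] (r < d × ∃[ h ] (InPowers F d h × y ≈ pow F g r * h))
  ≉0⇒∈coset {g} {y} d (g≉0 , generates) y≉0 with generates y y≉0
  ... | k , gᵏ≈y =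
    k % d , m%n<n k d ,
    pow F (pow F g (k / d)) d , (pow F g (k / d) , pow-≉0 (k / d) g≉0 , refl) ,
    trans (sym gᵏ≈y) (pow-rem-quot F g k d)

  coset-representatives⇒complete :
    ∀ {g} d m .{{_ : NonZero d}} → IsGenerator F g → Represented F d m 0# →
    (∀ k → 1 ≤ k → k ≤ d ∸ 1 → Represented F d m (pow F g k)) → IsComplete F d m
  coset-representatives⇒complete d m g-generates rep0 repPow y y∉G with ≈-dec y 0#
  ... | yes y≈0 = Represented-resp-≈ F {d} {m} (sym y≈0) rep0
  ... | no y≉0 with ≉0⇒∈coset d g-generates y≉0
  ... | zero , _ , h , h∈G , y≈1h =
    ⊥-elim (y∉G (InPowers-resp-≈ F {d} (sym (trans y≈1h (*-identityˡ h))) h∈G))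
  ... | suc r , r<d , h , h∈G , y≈gʳh =
    Represented-resp-≈ F {d} {m} (sym (trans y≈gʳh (*-comm _ h)))
      (Represented-*-InPowers {d} {m} h∈G (repPow (suc r) (s≤s z≤n) (ℕ.suc[m]≤n⇒m≤pred[n] r<d)))

mainTheorem10 : ∀ {c ℓ : Level} (F : CommutativeRing c ℓ) (q d m : ℕ)
    → IsPrimePower q
    → IsFiniteFieldOfSize F q
    → 1 ≤ d → d ∣ q ∸ 1
    → 2 ≤ m
    → IsCap F d m
    → (g : CommutativeRing.Carrier F) → IsGenerator F g
    → Represented F d m (CommutativeRing.0# F)
    → (∀ k → 1 ≤ k → k ≤ d ∸ 1 → Represented F d m (pow F g k))
    → IsComplete F d m
mainTheorem10 F q (suc d) m _ ff (s≤s z≤n) _ _ _ g g-generates =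
  coset-representatives⇒complete F ff (suc d) m g-generates
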